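{- Let $q,r$ be integers with $1\le r\le 0.3q$ and let $\alpha$ be a real number with $0.2\le\alpha\le1$. Assume $\mathrm{ex}(q^2+q+1-r,C_4)\ge \frac12 q(q+1)^2-\alpha rq$. Then there exists an integer $r_0\in[r,3r]$ such that $$\mathrm{ex}(q^2+q+1-r_0,C_4)\ge \frac12 q(q+1)^2-\alpha r_0 q$$ and $$\mathrm{ex}(q^2+q+1-r_0,C_4)-\mathrm{ex}(q^2+q-r_0,C_4)\ge 0.2q.$$ In particular, every graph on $q^2+q+1-r_0$ vertices with no $4$-cycle and exactly $\mathrm{ex}(q^2+q+1-r_0,C_4)$ edges has minimum degree at least $0.2q$.
   Context: $\mathrm{ex}(n,C_4)$ denotes the maximum number of edges in an $n$-vertex simple graph containing no cycle of length four as a subgraph.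
   Formalization: The parameter α ranges over the rationals in [1/5, 1] rather than the real numbers. -}

module Defs where

open import Data.Nat using (ℕ; zero; suc; _<ᵇ_; _≤_)
open import Data.Nat.ListAction using (sum)
open import Data.Bool using (Bool; true; false; if_then_else_; _∧_)
open import Data.Fin using (Fin; toℕ)
open import Data.List using (List; map; allFin)
open import Data.Integer using (+_)
open import Data.Rational using (ℚ; _/_)
open import Data.Product using (Σ; _×_; ∃; ∃-syntax)
open import Relation.Binary.PropositionalEquality using (_≡_; _≢_)
open import Relation.Nullary using (¬_)

record Graph (n : ℕ) : Set where
  field
    adj    : Fin n → Fin n → Bool
    sym    : ∀ i j → adj i j ≡ adj j i
    irrefl : ∀ i → adj i i ≡ false
open Graph public

degree : ∀ {n} → Graph n → Fin n → ℕ
degree {n} G v = sum (map (λ j → if adj G v j then 1 else 0) (allFin n))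

edges : ∀ {n} → Graph n → ℕ
edges {n} G =
  sum (map (λ i → sum (map (λ j → if (toℕ i <ᵇ toℕ j) ∧ adj G i j then 1 else 0)
                           (allFin n)))
           (allFin n))

HasC4 : ∀ {n} → Graph n → Set
HasC4 {n} G = ∃[ a ] ∃[ b ] ∃[ c ] ∃[ d ]
  ((a ≢ b) × (a ≢ c) × (a ≢ d) × (b ≢ c) × (b ≢ d) × (c ≢ d)) ×
  (adj G a b ≡ true) × (adj G b c ≡ true) × (adj G c d ≡ true) × (adj G d a ≡ true)

C4Free : ∀ {n} → Graph n → Set
C4Free G = ¬ HasC4 G

IsEx : ℕ → ℕ → Set
IsEx n e = (∃[ G ] (C4Free {n} G × edges G ≡ e)) ×
           (∀ (G : Graph n) → C4Free G → edges G ≤ e)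

toℚ : ℕ → ℚ
toℚ k = (+ k) / 1

-- Write f(s) = ex(q² + q + 1 − s) and look, among s = r, …, 3r, for the first s with
-- f(s) − f(s + 1) ≥ q/5.  Before it f loses less than q/5 per step, so, as α ≥ 1/5, the bound
-- f(s) ≥ ½q(q+1)² − αsq carries over from r to s.  At s, deleting a vertex v from an extremal
-- graph leaves a C₄-free graph on one vertex fewer, so deg v ≥ f(s) − f(s + 1) ≥ q/5.
-- If there were no such s, then, with n = q² + q − 3r, 2·ex(n) ≥ q(q+1)² − 2rq − 2(2r+1)q/5
-- ≥ n(q+1) − q, which violates Reiman's bound (2e)² ≤ n(2e + n(n−1)) for C₄-free graphs: it
-- follows from Cauchy–Schwarz on the degrees, since two vertices have at most one common
-- neighbour.

{-# OPTIONS --safe #-}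
module Submission where

open import Defs renaming (sym to adj-sym)

open import Level using (0ℓ)
open import Function using (_∘_)
open import Data.Empty using (⊥; ⊥-elim)
open import Data.Product using (_×_; _,_; ∃; ∃-syntax; proj₁; proj₂)
open import Data.Sum using (_⊎_; inj₁; inj₂; [_,_]′)
open import Relation.Binary.PropositionalEquality
open import Relation.Nullary using (Dec; does; yes; no; ¬?; contradiction; ofʸ; ofⁿ)
open import Relation.Nullary.Decidable using (map′; _×-dec_; dec-true)
open import Relation.Unary using (Pred; Decidable)

open import Data.Bool using (Bool; true; false; if_then_else_; _∧_; not)
open import Data.Bool.Properties using (∧-idem; ∧-conicalˡ; ∧-conicalʳ)
import Data.Bool.Properties as Bool
open import Data.Nat using (ℕ; zero; suc; _+_; _*_; _∸_; _^_; _≤_; _<_; _<ᵇ_; _≤?_; z≤n; s≤s; s≤s⁻¹)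
open import Data.Nat.Properties hiding (_≟_)
open import Data.Nat.Tactic.RingSolver using (solve-∀)
open import Data.Nat.ListAction using () renaming (sum to sumᴸ)
open import Data.Fin using (Fin; zero; suc; toℕ; punchIn)
open import Data.Fin.Properties using (toℕ-injective; _≟_; any?)
import Data.Fin.Properties as Fin
open import Data.Fin.Subset using (Subset)
open import Data.Fin.Subset.Properties using (anySubset?)
open import Data.List using (map; allFin)
import Data.List as List
open import Data.List.Properties using (map-tabulate)
open import Data.Vec using (Vec; []; _∷_; lookup; tabulate)
open import Data.Vec.Properties using (lookup∘tabulate)
open import Algebra.Properties.Semiring.Sum +-*-semiring
  using (sum; sum-syntax; sum-cong-≗; ∑-distrib-+; ∑-comm; sum-remove; *-distribˡ-sum; *-distribʳ-sum)

open import Data.Integer as ℤ using (+_)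
import Data.Integer.Properties as ℤₚ
open import Data.Integer.Tactic.RingSolver using () renaming (solve-∀ to ℤ-solve-∀)
open import Data.Rational using (ℚ; _/_; _-_; toℚᵘ)
open import Data.Rational as Q using ()
import Data.Rational.Properties as ℚₚ
open import Data.Rational.Solver using (module +-*-Solver)
open +-*-Solver using (solve; _:=_; _:+_; _:-_; _:*_)
open import Data.Rational.Unnormalised as ℚᵘ using (mkℚᵘ; *≡*; *≤*) renaming (_≃_ to _≃ᵘ_)
import Data.Rational.Unnormalised.Properties as ℚᵘₚ

𝟙 : Bool → ℕ
𝟙 b = if b then 1 else 0

𝟙-∧ : ∀ x y → 𝟙 x * 𝟙 y ≡ 𝟙 (x ∧ y)
𝟙-∧ true  y = +-identityʳ (𝟙 y)
𝟙-∧ false y = refl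

sumᴸ-allFin : ∀ n (f : Fin n → ℕ) → sumᴸ (map f (allFin n)) ≡ ∑[ i < n ] f i
sumᴸ-allFin n f = trans (cong sumᴸ (map-tabulate (λ i → i) f)) (sumᴸ-tabulate n f)
  where
  sumᴸ-tabulate : ∀ n (f : Fin n → ℕ) → sumᴸ (List.tabulate f) ≡ sum f
  sumᴸ-tabulate zero    f = refl
  sumᴸ-tabulate (suc n) f = cong (_+_ (f zero)) (sumᴸ-tabulate n (λ i → f (suc i)))

m+m≡2*m : ∀ m → m + m ≡ 2 * m
m+m≡2*m m = cong (_+_ m) (sym (+-identityʳ m))

∑-mono-≤ : ∀ {n} {f g : Fin n → ℕ} → (∀ i → f i ≤ g i) → sum f ≤ sum g
∑-mono-≤ {zero}  f≤g = z≤n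
∑-mono-≤ {suc n} f≤g = +-mono-≤ (f≤g zero) (∑-mono-≤ (λ i → f≤g (suc i)))

∑-const : ∀ n c → ∑[ i < n ] c ≡ n * c
∑-const zero    c = refl
∑-const (suc n) c = cong (_+_ c) (∑-const n c)

∑-*-∑ : ∀ {m n} (f : Fin m → ℕ) (g : Fin n → ℕ) → sum f * sum g ≡ ∑[ i < m ] ∑[ j < n ] (f i * g j)
∑-*-∑ f g = trans (*-distribʳ-sum (sum g) f) (sum-cong-≗ (λ i → *-distribˡ-sum (f i) g))

mn+mn≤m²+n² : ∀ m n → m * n + m * n ≤ m * m + n * n
mn+mn≤m²+n² m n = [ ordered , swapped ]′ (≤-total m n)
  where
  ordered : ∀ {m n} → m ≤ n → m * n + m * n ≤ m * m + n * n
  ordered {m} m≤n with m≤n⇒∃[o]m+o≡n m≤n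
  ... | d , refl = subst (m * (m + d) + m * (m + d) ≤_) (expand m d) (m≤m+n _ (d * d))
    where
    expand : ∀ m d → m * (m + d) + m * (m + d) + d * d ≡ m * m + (m + d) * (m + d)
    expand = solve-∀
  swapped : n ≤ m → m * n + m * n ≤ m * m + n * n
  swapped n≤m = subst₂ _≤_ (cong₂ _+_ (*-comm n m) (*-comm n m)) (+-comm (n * n) (m * m)) (ordered n≤m)

cauchy-schwarz : ∀ n (f : Fin n → ℕ) → sum f * sum f ≤ n * ∑[ i < n ] (f i * f i)
cauchy-schwarz n f = +-cancel-double (begin
  Σf * Σf + Σf * Σf
    ≡⟨ cong₂ _+_ (∑-*-∑ f f) (∑-*-∑ f f) ⟩
  ∑[ i < n ] ∑[ j < n ] (f i * f j) + ∑[ i < n ] ∑[ j < n ] (f i * f j)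
    ≡⟨ sym (trans (sum-cong-≗ (λ i → ∑-distrib-+ (λ j → f i * f j) (λ j → f i * f j))) (∑-distrib-+ Σⱼfᵢfⱼ Σⱼfᵢfⱼ)) ⟩
  ∑[ i < n ] ∑[ j < n ] (f i * f j + f i * f j)
    ≤⟨ ∑-mono-≤ (λ i → ∑-mono-≤ (λ j → mn+mn≤m²+n² (f i) (f j))) ⟩
  ∑[ i < n ] ∑[ j < n ] (f i * f i + f j * f j)
    ≡⟨ sum-cong-≗ (λ i → trans (∑-distrib-+ (λ _ → f i * f i) (λ j → f j * f j)) (cong (_+ Σf²) (∑-const n (f i * f i)))) ⟩
  ∑[ i < n ] (n * (f i * f i) + Σf²)
    ≡⟨ trans (∑-distrib-+ (λ i → n * (f i * f i)) (λ _ → Σf²)) (cong₂ _+_ (sym (*-distribˡ-sum n (λ i → f i * f i))) (∑-const n Σf²)) ⟩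
  n * Σf² + n * Σf² ∎)
  where
  open ≤-Reasoning
  Σf Σf² : ℕ
  Σf = sum f
  Σf² = ∑[ i < n ] (f i * f i)
  Σⱼfᵢfⱼ : Fin n → ℕ
  Σⱼfᵢfⱼ i = ∑[ j < n ] (f i * f j)
  +-cancel-double : ∀ {a b} → a + a ≤ b + b → a ≤ b
  +-cancel-double {a} {b} h = *-cancelˡ-≤ 2 (subst₂ _≤_ (m+m≡2*m a) (m+m≡2*m b) h)

∑-𝟙-≤1 : ∀ {n} (b : Fin n → Bool) → (∀ i j → b i ≡ true → b j ≡ true → i ≡ j) →
  ∑[ i < n ] 𝟙 (b i) ≤ 1
∑-𝟙-≤1 {zero}  b unique = z≤n
∑-𝟙-≤1 {suc n} b unique with b zero in b₀
... | true  = s≤s (≤-trans (∑-mono-≤ others-false) (≤-reflexive (trans (∑-const n 0) (*-zeroʳ n))))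
  where
  others-false : ∀ i → 𝟙 (b (suc i)) ≤ 0
  others-false i with b (suc i) in bᵢ
  ... | true  = contradiction (unique zero (suc i) b₀ bᵢ) λ ()
  ... | false = z≤n
... | false = ∑-𝟙-≤1 (λ i → b (suc i)) (λ i j bᵢ bⱼ → Fin.suc-injective (unique (suc i) (suc j) bᵢ bⱼ))

first-large-drop : ∀ (g : ℕ → ℕ) (c k : ℕ) →
  (∃[ j ] j ≤ k × g (suc j) + c ≤ g j × g 0 ≤ g j + j * c) ⊎ g 0 ≤ g (suc k) + suc k * c
first-large-drop g c zero with g 1 + c ≤? g 0
... | yes drop = inj₁ (0 , z≤n , drop , m≤m+n (g 0) 0)
... | no ¬drop = inj₂ (subst (g 0 ≤_) (cong (_+_ (g 1)) (sym (+-identityʳ c))) (<⇒≤ (≰⇒> ¬drop)))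
first-large-drop g c (suc k) with first-large-drop g c k
... | inj₁ (j , j≤k , found) = inj₁ (j , m≤n⇒m≤1+n j≤k , found)
... | inj₂ loss with g (2 + k) + c ≤? g (suc k)
...   | yes drop = inj₁ (suc k , ≤-refl , drop , loss)
...   | no ¬drop = inj₂ (begin
  g 0                          ≤⟨ loss ⟩
  g (suc k) + suc k * c        ≤⟨ +-monoˡ-≤ (suc k * c) (<⇒≤ (≰⇒> ¬drop)) ⟩
  g (2 + k) + c + suc k * c    ≡⟨ +-assoc (g (2 + k)) c (suc k * c) ⟩
  g (2 + k) + suc (suc k) * c  ∎)
  where open ≤-Reasoning

module _ {n} (G : Graph n) where

  adjᴺ : Fin n → Fin n → ℕ
  adjᴺ i j = 𝟙 (adj G i j)

  ordered-adjᴺ : Fin n → Fin n → ℕ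
  ordered-adjᴺ i j = 𝟙 ((toℕ i <ᵇ toℕ j) ∧ adj G i j)

  degree-∑ : ∀ v → degree G v ≡ ∑[ j < n ] adjᴺ v j
  degree-∑ v = sumᴸ-allFin n (adjᴺ v)

  edges-∑ : edges G ≡ ∑[ i < n ] ∑[ j < n ] ordered-adjᴺ i j
  edges-∑ = trans (sumᴸ-allFin n _) (sum-cong-≗ (λ i → sumᴸ-allFin n (ordered-adjᴺ i)))

  adjᴺ-split : ∀ i j → adjᴺ i j ≡ ordered-adjᴺ i j + ordered-adjᴺ j i
  adjᴺ-split i j with toℕ i <ᵇ toℕ j | <ᵇ-reflects-< (toℕ i) (toℕ j)
                    | toℕ j <ᵇ toℕ i | <ᵇ-reflects-< (toℕ j) (toℕ i)
  ... | true  | ofʸ i<j | true  | ofʸ j<i = contradiction j<i (<⇒≯ i<j)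
  ... | true  | _       | false | _       = sym (+-identityʳ _)
  ... | false | _       | true  | _       = cong 𝟙 (adj-sym G i j)
  ... | false | ofⁿ i≮j | false | ofⁿ j≮i rewrite toℕ-injective (≤-antisym (≮⇒≥ j≮i) (≮⇒≥ i≮j)) =
    cong 𝟙 (irrefl G j)

  handshake : ∑[ v < n ] degree G v ≡ 2 * edges G
  handshake = begin
    ∑[ i < n ] degree G i
      ≡⟨ sum-cong-≗ degree-∑ ⟩
    ∑[ i < n ] ∑[ j < n ] adjᴺ i j
      ≡⟨ sum-cong-≗ (λ i → sum-cong-≗ (adjᴺ-split i)) ⟩
    ∑[ i < n ] ∑[ j < n ] (ordered-adjᴺ i j + ordered-adjᴺ j i)
      ≡⟨ sum-cong-≗ (λ i → ∑-distrib-+ (ordered-adjᴺ i) (λ j → ordered-adjᴺ j i)) ⟩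
    ∑[ i < n ] (∑[ j < n ] ordered-adjᴺ i j + ∑[ j < n ] ordered-adjᴺ j i)
      ≡⟨ ∑-distrib-+ _ (λ i → ∑[ j < n ] ordered-adjᴺ j i) ⟩
    E + ∑[ i < n ] ∑[ j < n ] ordered-adjᴺ j i
      ≡⟨ cong (_+_ E) (∑-comm (λ i j → ordered-adjᴺ j i)) ⟩
    E + E
      ≡⟨ cong (λ x → x + x) (sym edges-∑) ⟩
    edges G + edges G
      ≡⟨ m+m≡2*m (edges G) ⟩
    2 * edges G ∎
    where
    open ≡-Reasoning
    E : ℕ
    E = ∑[ i < n ] ∑[ j < n ] ordered-adjᴺ i j

deleteVertex : ∀ {m} → Graph (suc m) → Fin (suc m) → Graph m
deleteVertex G v = record
  { adj    = λ i j → adj G (punchIn v i) (punchIn v j)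
  ; sym    = λ i j → adj-sym G (punchIn v i) (punchIn v j)
  ; irrefl = λ i → irrefl G (punchIn v i)
  }

deleteVertex-C4Free : ∀ {m} (G : Graph (suc m)) v → C4Free G → C4Free (deleteVertex G v)
deleteVertex-C4Free G v free (a , b , c , d , (a≢b , a≢c , a≢d , b≢c , b≢d , c≢d) , ab , bc , cd , da) =
  free (punchIn v a , punchIn v b , punchIn v c , punchIn v d ,
        (↑ a≢b , ↑ a≢c , ↑ a≢d , ↑ b≢c , ↑ b≢d , ↑ c≢d) , ab , bc , cd , da)
  where
  ↑ : ∀ {i j} → i ≢ j → punchIn v i ≢ punchIn v j
  ↑ i≢j = i≢j ∘ Fin.punchIn-injective v _ _

module _ {m} (G : Graph (suc m)) (v : Fin (suc m)) where

  private
    G-v : Graph m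
    G-v = deleteVertex G v

  degree-punchIn : ∀ i → degree G (punchIn v i) ≡ adjᴺ G (punchIn v i) v + degree G-v i
  degree-punchIn i = begin
    degree G (punchIn v i)
      ≡⟨ degree-∑ G (punchIn v i) ⟩
    ∑[ j < suc m ] adjᴺ G (punchIn v i) j
      ≡⟨ sum-remove (adjᴺ G (punchIn v i)) ⟩
    adjᴺ G (punchIn v i) v + ∑[ j < m ] adjᴺ G-v i j
      ≡⟨ cong (_+_ (adjᴺ G (punchIn v i) v)) (sym (degree-∑ G-v i)) ⟩
    adjᴺ G (punchIn v i) v + degree G-v i ∎
    where open ≡-Reasoning

  ∑-adjᴺ-punchIn : ∑[ i < m ] adjᴺ G (punchIn v i) v ≡ degree G v
  ∑-adjᴺ-punchIn = begin
    ∑[ i < m ] adjᴺ G (punchIn v i) v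
      ≡⟨ sum-cong-≗ (λ i → cong 𝟙 (adj-sym G (punchIn v i) v)) ⟩
    ∑[ i < m ] adjᴺ G v (punchIn v i)
      ≡⟨ cong (_+ ∑[ i < m ] adjᴺ G v (punchIn v i)) (sym (cong 𝟙 (irrefl G v))) ⟩
    adjᴺ G v v + ∑[ i < m ] adjᴺ G v (punchIn v i)
      ≡⟨ sym (sum-remove (adjᴺ G v)) ⟩
    ∑[ j < suc m ] adjᴺ G v j
      ≡⟨ sym (degree-∑ G v) ⟩
    degree G v ∎
    where open ≡-Reasoning

  edges-deleteVertex : edges G ≡ degree G v + edges G-v
  edges-deleteVertex = *-cancelˡ-≡ (edges G) _ 2 (begin
    2 * edges G
      ≡⟨ sym (handshake G) ⟩
    ∑[ i < suc m ] degree G i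
      ≡⟨ sum-remove (degree G) ⟩
    degree G v + ∑[ i < m ] degree G (punchIn v i)
      ≡⟨ cong (_+_ (degree G v)) (sum-cong-≗ degree-punchIn) ⟩
    degree G v + ∑[ i < m ] (adjᴺ G (punchIn v i) v + degree G-v i)
      ≡⟨ cong (_+_ (degree G v)) (∑-distrib-+ (λ i → adjᴺ G (punchIn v i) v) (degree G-v)) ⟩
    degree G v + (∑[ i < m ] adjᴺ G (punchIn v i) v + ∑[ i < m ] degree G-v i)
      ≡⟨ cong (_+_ (degree G v)) (cong₂ _+_ ∑-adjᴺ-punchIn (handshake G-v)) ⟩
    degree G v + (degree G v + 2 * edges G-v)                          ≡⟨ regroup (degree G v) (edges G-v) ⟩
    2 * (degree G v + edges G-v)                                       ∎)
    where
    open ≡-Reasoning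
    regroup : ∀ d e → d + (d + 2 * e) ≡ 2 * (d + e)
    regroup = solve-∀

  edges≤ex+degree : ∀ {e} → C4Free G → IsEx m e → edges G ≤ e + degree G v
  edges≤ex+degree {e} free (_ , maximal) = begin
    edges G                 ≡⟨ edges-deleteVertex ⟩
    degree G v + edges G-v  ≤⟨ +-monoʳ-≤ (degree G v) (maximal G-v (deleteVertex-C4Free G v free)) ⟩
    degree G v + e          ≡⟨ +-comm (degree G v) e ⟩
    e + degree G v          ∎
    where open ≤-Reasoning

extremal-min-degree : ∀ {m e₁ e₂} k c (G : Graph (suc m)) → C4Free G → edges G ≡ e₁ → IsEx m e₂ →
  k * e₂ + c ≤ k * e₁ → ∀ v → c ≤ k * degree G v
extremal-min-degree {e₂ = e₂} k c G free refl ex₂ drop v = +-cancelˡ-≤ (k * e₂) c (k * degree G v) (begin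
  k * e₂ + c               ≤⟨ drop ⟩
  k * edges G              ≤⟨ *-monoʳ-≤ k (edges≤ex+degree G v free ex₂) ⟩
  k * (e₂ + degree G v)    ≡⟨ *-distribˡ-+ k e₂ (degree G v) ⟩
  k * e₂ + k * degree G v  ∎)
  where open ≤-Reasoning

adjacent⇒≢ : ∀ {n} (G : Graph n) {a b} → adj G a b ≡ true → a ≢ b
adjacent⇒≢ G {a} ab refl with trans (sym ab) (irrefl G a)
... | ()

module _ {n} (G : Graph n) where

  codegree : Fin n → Fin n → ℕ
  codegree a b = ∑[ i < n ] (adjᴺ G i a * adjᴺ G i b)

  codegree-diagonal : ∀ a → codegree a a ≡ degree G a
  codegree-diagonal a = begin
    ∑[ i < n ] (adjᴺ G i a * adjᴺ G i a)
      ≡⟨ sum-cong-≗ (λ i → trans (𝟙-∧ (adj G i a) (adj G i a)) (cong 𝟙 (∧-idem (adj G i a)))) ⟩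
    ∑[ i < n ] adjᴺ G i a
      ≡⟨ sum-cong-≗ (λ i → cong 𝟙 (adj-sym G i a)) ⟩
    ∑[ i < n ] adjᴺ G a i
      ≡⟨ sym (degree-∑ G a) ⟩
    degree G a ∎
    where open ≡-Reasoning

  codegree≤1 : C4Free G → ∀ {a b} → a ≢ b → codegree a b ≤ 1
  codegree≤1 free {a} {b} a≢b = begin
    codegree a b                           ≡⟨ sum-cong-≗ (λ i → 𝟙-∧ (adj G i a) (adj G i b)) ⟩
    ∑[ i < n ] 𝟙 (adj G i a ∧ adj G i b)   ≤⟨ ∑-𝟙-≤1 _ common-neighbour-unique ⟩
    1                                      ∎
    where
    open ≤-Reasoning
    common-neighbour-unique : ∀ i j → adj G i a ∧ adj G i b ≡ true → adj G j a ∧ adj G j b ≡ true → i ≡ j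
    common-neighbour-unique i j iab jab with i ≟ j
    ... | yes i≡j = i≡j
    ... | no  i≢j = contradiction
      (a , i , b , j , (a≢i , a≢b , a≢j , i≢b , i≢j , b≢j) , trans (adj-sym G a i) ia , ib , trans (adj-sym G b j) jb , ja)
      free
      where
      ia : adj G i a ≡ true
      ia = ∧-conicalˡ _ _ iab
      ib : adj G i b ≡ true
      ib = ∧-conicalʳ _ _ iab
      ja : adj G j a ≡ true
      ja = ∧-conicalˡ _ _ jab
      jb : adj G j b ≡ true
      jb = ∧-conicalʳ _ _ jab
      a≢i : a ≢ i
      a≢i = adjacent⇒≢ G ia ∘ sym
      a≢j : a ≢ j
      a≢j = adjacent⇒≢ G ja ∘ sym
      i≢b : i ≢ b
      i≢b = adjacent⇒≢ G ib
      b≢j : b ≢ j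
      b≢j = adjacent⇒≢ G jb ∘ sym

∑-codegree≤ : ∀ {m} (G : Graph (suc m)) → C4Free G → ∀ a → ∑[ b < suc m ] codegree G a b ≤ degree G a + m
∑-codegree≤ {m} G free a = begin
  ∑[ b < suc m ] codegree G a b
    ≡⟨ sum-remove {i = a} (codegree G a) ⟩
  codegree G a a + ∑[ b < m ] codegree G a (punchIn a b)
    ≤⟨ +-mono-≤ (≤-reflexive (codegree-diagonal G a)) (∑-mono-≤ {g = λ _ → 1} off-diagonal) ⟩
  degree G a + ∑[ b < m ] 1
    ≡⟨ cong (_+_ (degree G a)) (trans (∑-const m 1) (*-identityʳ m)) ⟩
  degree G a + m ∎
  where
  open ≤-Reasoning
  off-diagonal : ∀ b → codegree G a (punchIn a b) ≤ 1
  off-diagonal b = codegree≤1 G free (Fin.punchInᵢ≢i a b ∘ sym)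

∑-degree² : ∀ {n} (G : Graph n) → ∑[ i < n ] (degree G i * degree G i) ≡ ∑[ a < n ] ∑[ b < n ] codegree G a b
∑-degree² {n} G = begin
  ∑[ i < n ] (degree G i * degree G i)
    ≡⟨ sum-cong-≗ square ⟩
  ∑[ i < n ] ∑[ a < n ] ∑[ b < n ] (adjᴺ G i a * adjᴺ G i b)
    ≡⟨ ∑-comm (λ i a → ∑[ b < n ] (adjᴺ G i a * adjᴺ G i b)) ⟩
  ∑[ a < n ] ∑[ i < n ] ∑[ b < n ] (adjᴺ G i a * adjᴺ G i b)
    ≡⟨ sum-cong-≗ (λ a → ∑-comm (λ i b → adjᴺ G i a * adjᴺ G i b)) ⟩
  ∑[ a < n ] ∑[ b < n ] codegree G a b ∎
  where
  open ≡-Reasoning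
  square : ∀ i → degree G i * degree G i ≡ ∑[ a < n ] ∑[ b < n ] (adjᴺ G i a * adjᴺ G i b)
  square i = trans (cong (λ d → d * d) (degree-∑ G i)) (∑-*-∑ (adjᴺ G i) (adjᴺ G i))

reiman : ∀ {n} (G : Graph n) → C4Free G → 2 * edges G * (2 * edges G) ≤ n * (2 * edges G + n * (n ∸ 1))
reiman {zero}  G free = z≤n
reiman {suc m} G free = begin
  2 * edges G * (2 * edges G)
    ≡⟨ cong (λ x → x * x) (sym (handshake G)) ⟩
  ∑[ i < n ] degree G i * ∑[ i < n ] degree G i
    ≤⟨ cauchy-schwarz n (degree G) ⟩
  n * ∑[ i < n ] (degree G i * degree G i)
    ≡⟨ cong (n *_) (∑-degree² G) ⟩
  n * ∑[ a < n ] ∑[ b < n ] codegree G a b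
    ≤⟨ *-monoʳ-≤ n (∑-mono-≤ {f = λ a → ∑[ b < n ] codegree G a b} {g = λ a → degree G a + m} (∑-codegree≤ G free)) ⟩
  n * ∑[ a < n ] (degree G a + m)
    ≡⟨ cong (n *_) (trans (∑-distrib-+ (degree G) (λ _ → m)) (cong₂ _+_ (handshake G) (∑-const n m))) ⟩
  n * (2 * edges G + n * m) ∎
  where
  open ≤-Reasoning
  n : ℕ
  n = suc m

module _ {n} (G H : Graph n) (G≗H : ∀ i j → adj G i j ≡ adj H i j) where

  edges-cong : edges G ≡ edges H
  edges-cong = trans (edges-∑ G) (trans
    (sum-cong-≗ (λ i → sum-cong-≗ (λ j → cong (λ b → 𝟙 ((toℕ i <ᵇ toℕ j) ∧ b)) (G≗H i j))))
    (sym (edges-∑ H)))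

  C4Free-cong : C4Free G → C4Free H
  C4Free-cong free (a , b , c , d , distinct , ab , bc , cd , da) =
    free (a , b , c , d , distinct , trans (G≗H a b) ab , trans (G≗H b c) bc , trans (G≗H c d) cd , trans (G≗H d a) da)

edges≤n*n : ∀ {n} (G : Graph n) → edges G ≤ n * n
edges≤n*n {n} G = begin
  edges G                                   ≡⟨ edges-∑ G ⟩
  ∑[ i < n ] ∑[ j < n ] ordered-adjᴺ G i j  ≤⟨ ∑-mono-≤ {g = λ _ → n} row≤n ⟩
  ∑[ i < n ] n                              ≡⟨ ∑-const n n ⟩
  n * n                                     ∎
  where
  open ≤-Reasoning
  𝟙≤1 : ∀ b → 𝟙 b ≤ 1
  𝟙≤1 true  = ≤-refl
  𝟙≤1 false = z≤n
  row≤n : ∀ i → ∑[ j < n ] ordered-adjᴺ G i j ≤ n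
  row≤n i = ≤-trans (∑-mono-≤ {f = ordered-adjᴺ G i} {g = λ _ → 1} (λ j → 𝟙≤1 _))
                    (≤-reflexive (trans (∑-const n 1) (*-identityʳ n)))

HasC4? : ∀ {n} (G : Graph n) → Dec (HasC4 G)
HasC4? G =
  any? λ a → any? λ b → any? λ c → any? λ d →
    (¬? (a ≟ b) ×-dec ¬? (a ≟ c) ×-dec ¬? (a ≟ d) ×-dec ¬? (b ≟ c) ×-dec ¬? (b ≟ d) ×-dec ¬? (c ≟ d)) ×-dec
    (adj G a b Bool.≟ true ×-dec adj G b c Bool.≟ true ×-dec adj G c d Bool.≟ true ×-dec adj G d a Bool.≟ true)

Searchable : Set → Set₁
Searchable A = ∀ {P : Pred A 0ℓ} → Decidable P → Dec (∃ P)

Vec-searchable : ∀ {A} → Searchable A → ∀ m → Searchable (Vec A m)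
Vec-searchable search zero    P? = map′ ([] ,_) (λ { ([] , p) → p }) (P? [])
Vec-searchable search (suc m) P? =
  map′ (λ (x , xs , p) → x ∷ xs , p) (λ { (x ∷ xs , p) → x , xs , p })
       (search (λ x → Vec-searchable search m (λ xs → P? (x ∷ xs))))

≟-sym : ∀ {n} (i j : Fin n) → does (i ≟ j) ≡ does (j ≟ i)
≟-sym i j with i ≟ j | j ≟ i
... | yes _   | yes _   = refl
... | no  _   | no  _   = refl
... | yes i≡j | no  j≢i = contradiction (sym i≡j) j≢i
... | no  i≢j | yes j≡i = contradiction (sym j≡i) i≢j

-- Graph records contain proofs, so extremal graphs are searched for among adjacency matrices;
-- fromCode keeps the symmetric off-diagonal part of a matrix.
Code : ℕ → Set
Code n = Vec (Subset n) n

fromCode : ∀ {n} → Code n → Graph n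
adj    (fromCode M) i j = not (does (i ≟ j)) ∧ (lookup (lookup M i) j ∧ lookup (lookup M j) i)
adj-sym (fromCode M) i j = cong₂ (λ x y → not x ∧ y) (≟-sym i j) (Bool.∧-comm (lookup (lookup M i) j) _)
irrefl (fromCode M) i =
  cong (λ x → not x ∧ (lookup (lookup M i) i ∧ lookup (lookup M i) i)) (dec-true (i ≟ i) refl)

toCode : ∀ {n} → Graph n → Code n
toCode G = tabulate (λ i → tabulate (adj G i))

fromCode-toCode : ∀ {n} (G : Graph n) i j → adj (fromCode (toCode G)) i j ≡ adj G i j
fromCode-toCode G i j
  rewrite lookup∘tabulate (λ i → tabulate (adj G i)) i | lookup∘tabulate (λ i → tabulate (adj G i)) j
        | lookup∘tabulate (adj G i) j | lookup∘tabulate (adj G j) i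
  with i ≟ j
... | yes refl = sym (irrefl G i)
... | no  _    = trans (cong (adj G i j ∧_) (adj-sym G j i)) (∧-idem (adj G i j))

module _ {n} (G : Graph n) where

  toCode-C4Free : C4Free G → C4Free (fromCode (toCode G))
  toCode-C4Free = C4Free-cong G (fromCode (toCode G)) (λ i j → sym (fromCode-toCode G i j))

  edges-toCode : edges G ≡ edges (fromCode (toCode G))
  edges-toCode = edges-cong G (fromCode (toCode G)) (λ i j → sym (fromCode-toCode G i j))

emptyGraph : ∀ {n} → Graph n
emptyGraph = record { adj = λ _ _ → false ; sym = λ _ _ → refl ; irrefl = λ _ → refl }

emptyGraph-C4Free : ∀ {n} → C4Free (emptyGraph {n})
emptyGraph-C4Free (_ , _ , _ , _ , _ , () , _)

greatest-below : ∀ {P : Pred ℕ 0ℓ} → Decidable P → P 0 → ∀ B → (∀ k → P k → k ≤ B) →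
  ∃[ k ] P k × (∀ j → P j → j ≤ k)
greatest-below P? p₀ B bounded with P? B
greatest-below P? p₀ B       bounded | yes pB = B , pB , bounded
greatest-below P? p₀ zero    bounded | no ¬p₀ = contradiction p₀ ¬p₀
greatest-below P? p₀ (suc B) bounded | no ¬pB =
  greatest-below P? p₀ B (λ j pj → s≤s⁻¹ (≤∧≢⇒< (bounded j pj) λ { refl → ¬pB pj }))

-- Abstract, so that ex never unfolds into the exhaustive search.
abstract
  IsEx-exists : ∀ n → ∃ (IsEx n)
  IsEx-exists n with greatest-below attainable? attainable-0 (n * n) (λ k (M , _ , k≤) → ≤-trans k≤ (edges≤n*n (fromCode M)))
    where
    Attainable : Pred ℕ 0ℓ
    Attainable k = ∃[ M ] C4Free (fromCode {n} M) × k ≤ edges (fromCode M)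
    attainable? : Decidable Attainable
    attainable? k = Vec-searchable anySubset? n (λ M → ¬? (HasC4? (fromCode M)) ×-dec k ≤? edges (fromCode M))
    attainable-0 : Attainable 0
    attainable-0 = toCode emptyGraph , toCode-C4Free emptyGraph emptyGraph-C4Free , z≤n
  ... | k , (M , free , k≤) , greatest =
    k , (fromCode M , free , ≤-antisym (greatest _ (M , free , ≤-refl)) k≤) , λ G G-free →
      greatest (edges G) (toCode G , toCode-C4Free G G-free , ≤-reflexive (edges-toCode G))

  ex : ℕ → ℕ
  ex n = proj₁ (IsEx-exists n)

  ex-IsEx : ∀ n → IsEx n (ex n)
  ex-IsEx n = proj₂ (IsEx-exists n)

IsEx-unique : ∀ {n e e′} → IsEx n e → IsEx n e′ → e ≡ e′
IsEx-unique ((G , G-free , refl) , G-max) ((H , H-free , refl) , H-max) = ≤-antisym (H-max G G-free) (G-max H H-free)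

m^2≡m*m : ∀ m → m ^ 2 ≡ m * m
m^2≡m*m m = cong (m *_) (*-identityʳ m)

m^2+m≡m*suc-m : ∀ m → m ^ 2 + m ≡ m * suc m
m^2+m≡m*suc-m m = trans (cong (_+ m) (m^2≡m*m m)) (trans (+-comm (m * m) m) (sym (*-suc m m)))

m+1∸suc-n≡m∸n : ∀ m n → m + 1 ∸ suc n ≡ m ∸ n
m+1∸suc-n≡m∸n m n = cong (_∸ suc n) (+-comm m 1)

m+1∸n≡suc[m∸n] : ∀ {m n} → n ≤ m → m + 1 ∸ n ≡ suc (m ∸ n)
m+1∸n≡suc[m∸n] {m} {n} n≤m = trans (+-∸-comm 1 n≤m) (+-comm (m ∸ n) 1)

10r≤3q⇒3r≤q : ∀ {q r} → 10 * r ≤ 3 * q → 3 * r ≤ q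
10r≤3q⇒3r≤q {q} {r} 10r≤3q = *-cancelˡ-≤ 3 (begin
  3 * (3 * r)  ≡⟨ sym (*-assoc 3 3 r) ⟩
  9 * r        ≤⟨ *-monoˡ-≤ r (n≤1+n 9) ⟩
  10 * r       ≤⟨ 10r≤3q ⟩
  3 * q        ∎)
  where open ≤-Reasoning

x²-nx-mono : ∀ {n b y K} → n ≤ 2 * b → b ≤ y → y * y ≤ n * y + K → b * b ≤ n * b + K
x²-nx-mono {n} {b} {_} {K} n≤2b b≤y y²≤ with m≤n⇒∃[o]m+o≡n b≤y
... | d , refl = +-cancelʳ-≤ (n * d) (b * b) (n * b + K) (begin
  b * b + n * d                ≤⟨ +-monoʳ-≤ (b * b) (≤-trans (*-monoˡ-≤ d n≤2b) (m≤m+n (2 * b * d) (d * d))) ⟩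
  b * b + (2 * b * d + d * d)  ≡⟨ expand b d ⟩
  (b + d) * (b + d)            ≤⟨ y²≤ ⟩
  n * (b + d) + K              ≡⟨ regroup n b d K ⟩
  n * b + K + n * d            ∎)
  where
  open ≤-Reasoning
  expand : ∀ b d → b * b + (2 * b * d + d * d) ≡ (b + d) * (b + d)
  expand = solve-∀
  regroup : ∀ n b d K → n * (b + d) + K ≡ n * b + K + n * d
  regroup = solve-∀

-- With r = 1 + a and q = 3r + s one has n = q² + q − 3r, u = n − q and b = n(q+1) − q;
-- the last summand is positive.
reiman-excess : ∀ a s →
  let q  = 3 * suc a + s
      n′ = (2 + 3 * a + s) * (4 + 3 * a + s) + s
      n  = suc n′
      u  = q * (2 + 3 * a + s) + s
      b  = n * q + u
  in b * b ≡ n * b + n * (n * n′) + (u * u + n * q + n * ((1 + 3 * a) * q * q + 3 * suc a * s))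
reiman-excess = solve-∀

reiman-violated : ∀ a s {y} →
  let q  = 3 * suc a + s
      n  = suc ((2 + 3 * a + s) * (4 + 3 * a + s) + s)
  in n * suc q ≤ y + q → y * y ≤ n * (y + n * (n ∸ 1)) → ⊥
reiman-violated a s {y} lower reiman-y =
  <⇒≱ (m<m+n (n * b + K) 0<excess) (≤-trans (≤-reflexive (sym (reiman-excess a s))) b²≤)
  where
  q n′ n u b K excess : ℕ
  q  = 3 * suc a + s
  n′ = (2 + 3 * a + s) * (4 + 3 * a + s) + s
  n  = suc n′
  u  = q * (2 + 3 * a + s) + s
  b  = n * q + u
  K  = n * (n * n′)
  excess = u * u + n * q + n * ((1 + 3 * a) * q * q + 3 * suc a * s)
  0<excess : 0 < excess
  0<excess = ≤-trans (s≤s z≤n) (≤-trans (m≤n+m (n * q) (u * u)) (m≤m+n _ _))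
  n*suc-q≡b+q : n * suc q ≡ b + q
  n*suc-q≡b+q = split a s
    where
    split : ∀ a s →
      let q = 3 * suc a + s ; n = suc ((2 + 3 * a + s) * (4 + 3 * a + s) + s)
      in n * suc q ≡ n * q + (q * (2 + 3 * a + s) + s) + q
    split = solve-∀
  n≤2b : n ≤ 2 * b
  n≤2b = ≤-trans (m≤m*n n q) (≤-trans (m≤m+n (n * q) u) (m≤m+n b (b + 0)))
  b≤y : b ≤ y
  b≤y = +-cancelʳ-≤ q b y (subst (_≤ y + q) n*suc-q≡b+q lower)
  b²≤ : b * b ≤ n * b + K
  b²≤ = x²-nx-mono n≤2b b≤y (subst (y * y ≤_) (*-distribˡ-+ n y (n * n′)) reiman-y)

reiman-excludes : ∀ {q r n y} → 1 ≤ r → 3 * r ≤ q → n + 3 * r ≡ q * suc q →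
  n * suc q ≤ y + q → y * y ≤ n * (y + n * (n ∸ 1)) → ⊥
reiman-excludes {r = suc a} {n} _ 3r≤q n+3r≡q*suc-q with m≤n⇒∃[o]m+o≡n 3r≤q
... | s , refl with +-cancelʳ-≡ (3 * suc a) n (suc ((2 + 3 * a + s) * (4 + 3 * a + s) + s)) (trans n+3r≡q*suc-q (vertex-count a s))
  where
  vertex-count : ∀ a s → let q = 3 * suc a + s in
    q * suc q ≡ suc ((2 + 3 * a + s) * (4 + 3 * a + s) + s) + 3 * suc a
  vertex-count = solve-∀
... | refl = reiman-violated a s

edges-lower-bound : ∀ {q r n F e} → n + 3 * r ≡ q * suc q →
  q * (q + 1) ^ 2 ≤ 2 * (F + r * q) → 5 * F ≤ 5 * e + suc (2 * r) * q → n * suc q ≤ 2 * e + q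
edges-lower-bound {q} {r} {n} {F} {e} n+3r≡q*suc-q F-large drops = *-cancelˡ-≤ 5 (begin
  5 * (n * suc q)      ≤⟨ +-cancelʳ-≤ (14 * r * q) _ _ with-r-terms ⟩
  5 * (2 * e) + 2 * q  ≤⟨ +-monoʳ-≤ (5 * (2 * e)) (*-monoˡ-≤ q {2} {5} (s≤s (s≤s z≤n))) ⟩
  5 * (2 * e) + 5 * q  ≡⟨ sym (*-distribˡ-+ 5 (2 * e) q) ⟩
  5 * (2 * e + q)      ∎)
  where
  open ≤-Reasoning
  collect : ∀ n r q → 5 * (n * suc q) + 14 * r * q + (r * q + 15 * r) ≡ 5 * ((n + 3 * r) * suc q)
  collect = solve-∀
  square : ∀ q → 5 * (q * suc q * suc q) ≡ 5 * (q * ((q + 1) * (q + 1)))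
  square = solve-∀
  spread : ∀ F r q → 5 * (2 * (F + r * q)) ≡ 2 * (5 * F) + 10 * r * q
  spread = solve-∀
  gather : ∀ e r q → 2 * (5 * e + suc (2 * r) * q) + 10 * r * q ≡ 5 * (2 * e) + 2 * q + 14 * r * q
  gather = solve-∀
  with-r-terms : 5 * (n * suc q) + 14 * r * q ≤ 5 * (2 * e) + 2 * q + 14 * r * q
  with-r-terms = begin
    5 * (n * suc q) + 14 * r * q                     ≤⟨ m≤m+n _ (r * q + 15 * r) ⟩
    5 * (n * suc q) + 14 * r * q + (r * q + 15 * r)  ≡⟨ collect n r q ⟩
    5 * ((n + 3 * r) * suc q)                        ≡⟨ cong (λ m → 5 * (m * suc q)) n+3r≡q*suc-q ⟩
    5 * (q * suc q * suc q)                          ≡⟨ square q ⟩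
    5 * (q * ((q + 1) * (q + 1)))                    ≡⟨ cong (λ x → 5 * (q * x)) (sym (m^2≡m*m (q + 1))) ⟩
    5 * (q * (q + 1) ^ 2)                            ≤⟨ *-monoʳ-≤ 5 F-large ⟩
    5 * (2 * (F + r * q))                            ≡⟨ spread F r q ⟩
    2 * (5 * F) + 10 * r * q                         ≤⟨ +-monoˡ-≤ (10 * r * q) (*-monoʳ-≤ 2 drops) ⟩
    2 * (5 * e + suc (2 * r) * q) + 10 * r * q       ≡⟨ gather e r q ⟩
    5 * (2 * e) + 2 * q + 14 * r * q                 ∎

toℚᵘ-/ : ∀ a d → toℚᵘ (+ a / suc d) ≃ᵘ mkℚᵘ (+ a) d
toℚᵘ-/ a d = ℚₚ.toℚᵘ-fromℚᵘ (mkℚᵘ (+ a) d)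

toℚ-nonNegative : ∀ k → Q.NonNegative (toℚ k)
toℚ-nonNegative k = ℚₚ.normalize-nonNeg k 1

toℚ-+ : ∀ m n → toℚ (m + n) ≡ toℚ m Q.+ toℚ n
toℚ-+ m n = ℚₚ.toℚᵘ-injective (begin
  toℚᵘ (toℚ (m + n))                  ≈⟨ toℚᵘ-/ (m + n) 0 ⟩
  mkℚᵘ (+ (m + n)) 0                  ≈⟨ *≡* (trans (cong (ℤ._* + 1) (ℤₚ.pos-+ m n)) (cross (+ m) (+ n))) ⟩
  mkℚᵘ (+ m) 0 ℚᵘ.+ mkℚᵘ (+ n) 0      ≈⟨ ℚᵘₚ.+-cong (toℚᵘ-/ m 0) (toℚᵘ-/ n 0) ⟨
  toℚᵘ (toℚ m) ℚᵘ.+ toℚᵘ (toℚ n)      ≈⟨ ℚₚ.toℚᵘ-homo-+ (toℚ m) (toℚ n) ⟨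
  toℚᵘ (toℚ m Q.+ toℚ n)              ∎)
  where
  open ℚᵘₚ.≃-Reasoning
  cross : ∀ x y → (x ℤ.+ y) ℤ.* + 1 ≡ (x ℤ.* + 1 ℤ.+ y ℤ.* + 1) ℤ.* + 1
  cross = ℤ-solve-∀

/2≤toℚ⇒≤2* : ∀ {a b} → + a / 2 Q.≤ toℚ b → a ≤ 2 * b
/2≤toℚ⇒≤2* {a} {b} h = ℤₚ.drop‿+≤+ (subst₂ ℤ._≤_ (ℤₚ.*-identityʳ (+ a)) (trans (sym (ℤₚ.pos-* b 2)) (cong +_ (*-comm b 2)))
  (ℚᵘₚ.drop-*≤* (ℚᵘₚ.≤-respˡ-≃ (toℚᵘ-/ a 1) (ℚᵘₚ.≤-respʳ-≃ (toℚᵘ-/ b 0) (ℚₚ.toℚᵘ-mono-≤ h)))))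

toℚ≤toℚ+¹/₅*toℚ : ∀ {m n k} → 5 * m ≤ 5 * n + k → toℚ m Q.≤ toℚ n Q.+ + 1 / 5 Q.* toℚ k
toℚ≤toℚ+¹/₅*toℚ {m} {n} {k} h = ℚₚ.toℚᵘ-cancel-≤ (begin
  toℚᵘ (toℚ m)                                        ≃⟨ toℚᵘ-/ m 0 ⟩
  mkℚᵘ (+ m) 0                                        ≤⟨ *≤* (subst₂ ℤ._≤_ lhs rhs (ℤ.+≤+ h)) ⟩
  mkℚᵘ (+ n) 0 ℚᵘ.+ mkℚᵘ (+ 1) 4 ℚᵘ.* mkℚᵘ (+ k) 0    ≃⟨ ℚᵘₚ.+-cong (toℚᵘ-/ n 0) (ℚᵘₚ.*-cong (toℚᵘ-/ 1 4) (toℚᵘ-/ k 0)) ⟨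
  toℚᵘ (toℚ n) ℚᵘ.+ toℚᵘ (+ 1 / 5) ℚᵘ.* toℚᵘ (toℚ k)  ≃⟨ ℚᵘₚ.+-congʳ (toℚᵘ (toℚ n)) (ℚₚ.toℚᵘ-homo-* (+ 1 / 5) (toℚ k)) ⟨
  toℚᵘ (toℚ n) ℚᵘ.+ toℚᵘ (+ 1 / 5 Q.* toℚ k)          ≃⟨ ℚₚ.toℚᵘ-homo-+ (toℚ n) (+ 1 / 5 Q.* toℚ k) ⟨
  toℚᵘ (toℚ n Q.+ + 1 / 5 Q.* toℚ k)                  ∎)
  where
  open ℚᵘₚ.≤-Reasoning
  cross : ∀ x y → + 5 ℤ.* x ℤ.+ y ≡ (x ℤ.* + 5 ℤ.+ + 1 ℤ.* y ℤ.* + 1) ℤ.* + 1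
  cross = ℤ-solve-∀
  lhs : + (5 * m) ≡ + m ℤ.* + 5
  lhs = trans (ℤₚ.pos-* 5 m) (ℤₚ.*-comm (+ 5) (+ m))
  rhs : + (5 * n + k) ≡ (+ n ℤ.* + 5 ℤ.+ + 1 ℤ.* + k ℤ.* + 1) ℤ.* + 1
  rhs = trans (ℤₚ.pos-+ (5 * n) k) (trans (cong (ℤ._+ + k) (ℤₚ.pos-* 5 n)) (cross (+ n) (+ k)))

ℚ-lower-bound⇒ℕ : ∀ {A B C α} → α Q.≤ + 1 / 1 → + A / 2 - α Q.* toℚ B Q.≤ toℚ C → A ≤ 2 * (C + B)
ℚ-lower-bound⇒ℕ {A} {B} {C} {α} α≤1 deficit = /2≤toℚ⇒≤2* {A} {C + B} (begin
  + A / 2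
    ≡⟨ sym (x-y+y≡x (+ A / 2) (α Q.* toℚ B)) ⟩
  + A / 2 - α Q.* toℚ B Q.+ α Q.* toℚ B
    ≤⟨ ℚₚ.+-monoˡ-≤ (α Q.* toℚ B) deficit ⟩
  toℚ C Q.+ α Q.* toℚ B
    ≤⟨ ℚₚ.+-monoʳ-≤ (toℚ C) (ℚₚ.*-monoʳ-≤-nonNeg (toℚ B) {{toℚ-nonNegative B}} α≤1) ⟩
  toℚ C Q.+ + 1 / 1 Q.* toℚ B
    ≡⟨ cong (toℚ C Q.+_) (ℚₚ.*-identityˡ (toℚ B)) ⟩
  toℚ C Q.+ toℚ B
    ≡⟨ sym (toℚ-+ C B) ⟩
  toℚ (C + B) ∎)
  where
  open ℚₚ.≤-Reasoning
  x-y+y≡x : ∀ x y → x - y Q.+ y ≡ x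
  x-y+y≡x = solve 2 (λ x y → x :- y :+ y := x) refl

ℚ-lower-bound-step : ∀ {H α r j q F E} → + 1 / 5 Q.≤ α → H - α Q.* toℚ (r * q) Q.≤ toℚ F →
  5 * F ≤ 5 * E + j * q → H - α Q.* toℚ ((j + r) * q) Q.≤ toℚ E
ℚ-lower-bound-step {H} {α} {r} {j} {q} {F} {E} ⅕≤α bound-at-r drops = begin
  H - α Q.* toℚ ((j + r) * q)
    ≡⟨ cong (λ x → H - α Q.* x) split ⟩
  H - α Q.* (toℚ (r * q) Q.+ toℚ (j * q))
    ≡⟨ distribute H α (toℚ (r * q)) (toℚ (j * q)) ⟩
  H - α Q.* toℚ (r * q) - α Q.* toℚ (j * q)
    ≤⟨ ℚₚ.+-monoˡ-≤ (Q.- (α Q.* toℚ (j * q))) bound-at-r ⟩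
  toℚ F - α Q.* toℚ (j * q)
    ≤⟨ ℚₚ.+-monoʳ-≤ (toℚ F) (ℚₚ.neg-antimono-≤ (ℚₚ.*-monoʳ-≤-nonNeg (toℚ (j * q)) {{toℚ-nonNegative (j * q)}} ⅕≤α)) ⟩
  toℚ F - ⅕ Q.* toℚ (j * q)
    ≤⟨ ℚₚ.+-monoˡ-≤ (Q.- (⅕ Q.* toℚ (j * q))) (toℚ≤toℚ+¹/₅*toℚ {F} {E} {j * q} drops) ⟩
  toℚ E Q.+ ⅕ Q.* toℚ (j * q) - ⅕ Q.* toℚ (j * q)
    ≡⟨ x+y-y≡x (toℚ E) (⅕ Q.* toℚ (j * q)) ⟩
  toℚ E ∎
  where
  open ℚₚ.≤-Reasoning
  ⅕ : ℚ
  ⅕ = + 1 / 5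
  split : toℚ ((j + r) * q) ≡ toℚ (r * q) Q.+ toℚ (j * q)
  split = trans (cong toℚ (trans (*-distribʳ-+ q j r) (+-comm (j * q) (r * q)))) (toℚ-+ (r * q) (j * q))
  distribute : ∀ h a x y → h - a Q.* (x Q.+ y) ≡ h - a Q.* x - a Q.* y
  distribute = solve 4 (λ h a x y → h :- a :* (x :+ y) := h :- a :* x :- a :* y) refl
  x+y-y≡x : ∀ x y → x Q.+ y - y ≡ x
  x+y-y≡x = solve 2 (λ x y → x :+ y :- y := x) refl


small-drops-impossible : ∀ {q r α} → 1 ≤ r → 3 * r ≤ q → α Q.≤ + 1 / 1 →
  (∀ e → IsEx (q ^ 2 + q + 1 ∸ r) e → + (q * (q + 1) ^ 2) / 2 - α Q.* toℚ (r * q) Q.≤ toℚ e) →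
  5 * ex (q ^ 2 + q + 1 ∸ r) ≤ 5 * ex (q ^ 2 + q + 1 ∸ suc (2 * r + r)) + suc (2 * r) * q → ⊥
small-drops-impossible {q} {r} 1≤r 3r≤q α≤1 bound-at-r drops =
  reiman-excludes {q} {r} {n} {2 * e} 1≤r 3r≤q count
    (edges-lower-bound {q} {r} {n} {F} {e} count (ℚ-lower-bound⇒ℕ {C = F} α≤1 (bound-at-r F (ex-IsEx _))) drops)
    reiman-extremal
  where
  n e F : ℕ
  n = q ^ 2 + q + 1 ∸ suc (2 * r + r)
  e = ex n
  F = ex (q ^ 2 + q + 1 ∸ r)
  reiman-extremal : 2 * e * (2 * e) ≤ n * (2 * e + n * (n ∸ 1))
  reiman-extremal = let (G , free , edges≡) = proj₁ (ex-IsEx n) in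
    subst (λ e → 2 * e * (2 * e) ≤ n * (2 * e + n * (n ∸ 1))) edges≡ (reiman G free)
  count : n + 3 * r ≡ q * suc q
  count = begin
    n + 3 * r
      ≡⟨ cong₂ _+_ (m+1∸suc-n≡m∸n (q ^ 2 + q) (2 * r + r)) (+-comm r (2 * r)) ⟩
    q ^ 2 + q ∸ (2 * r + r) + (2 * r + r)
      ≡⟨ m∸n+n≡m (≤-trans (≤-reflexive (+-comm (2 * r) r)) (≤-trans 3r≤q (m≤n+m q (q ^ 2)))) ⟩
    q ^ 2 + q
      ≡⟨ m^2+m≡m*suc-m q ⟩
    q * suc q ∎
    where open ≡-Reasoning

lemma4p1 : (q r : ℕ) (α : ℚ) →
    1 ≤ r → 10 * r ≤ 3 * q →
    (+ 1 / 5) Q.≤ α → α Q.≤ (+ 1 / 1) →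
    (∀ e → IsEx (q ^ 2 + q + 1 ∸ r) e →
      (+ (q * (q + 1) ^ 2) / 2) - α Q.* toℚ (r * q) Q.≤ toℚ e) →
    ∃[ r₀ ] ((r ≤ r₀) × (r₀ ≤ 3 * r) ×
      (∀ e₁ e₂ → IsEx (q ^ 2 + q + 1 ∸ r₀) e₁ → IsEx (q ^ 2 + q ∸ r₀) e₂ →
        ((+ (q * (q + 1) ^ 2) / 2) - α Q.* toℚ (r₀ * q) Q.≤ toℚ e₁) ×
        (5 * e₂ + q ≤ 5 * e₁) ×
        (∀ (G : Graph (q ^ 2 + q + 1 ∸ r₀)) → C4Free G → edges G ≡ e₁ →
          ∀ v → q ≤ 5 * degree G v)))
lemma4p1 q r α 1≤r 10r≤3q ⅕≤α α≤1 bound-at-r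
  with first-large-drop (λ j → 5 * ex (q ^ 2 + q + 1 ∸ (j + r))) q (2 * r)
... | inj₂ drops = ⊥-elim (small-drops-impossible 1≤r (10r≤3q⇒3r≤q {q} {r} 10r≤3q) α≤1 bound-at-r drops)
... | inj₁ (j , j≤2r , drop , drops) = r₀ , m≤n+m r j , r₀≤3r , consequences
  where
  r₀ : ℕ
  r₀ = j + r
  r₀≤3r : r₀ ≤ 3 * r
  r₀≤3r = ≤-trans (+-monoˡ-≤ r j≤2r) (≤-reflexive (+-comm (2 * r) r))
  n : ℕ
  n = q ^ 2 + q ∸ r₀
  drop′ : 5 * ex n + q ≤ 5 * ex (q ^ 2 + q + 1 ∸ r₀)
  drop′ = subst (λ m → 5 * ex m + q ≤ 5 * ex (q ^ 2 + q + 1 ∸ r₀)) (m+1∸suc-n≡m∸n (q ^ 2 + q) r₀) drop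
  min-degree : ∀ {m} → m ≡ suc n → (G : Graph m) → C4Free G → edges G ≡ ex (q ^ 2 + q + 1 ∸ r₀) →
    ∀ v → q ≤ 5 * degree G v
  min-degree refl G free edges≡ = extremal-min-degree 5 q G free edges≡ (ex-IsEx n) drop′
  consequences : ∀ e₁ e₂ → IsEx (q ^ 2 + q + 1 ∸ r₀) e₁ → IsEx n e₂ →
    ((+ (q * (q + 1) ^ 2) / 2) - α Q.* toℚ (r₀ * q) Q.≤ toℚ e₁) × (5 * e₂ + q ≤ 5 * e₁) ×
    (∀ (G : Graph (q ^ 2 + q + 1 ∸ r₀)) → C4Free G → edges G ≡ e₁ → ∀ v → q ≤ 5 * degree G v)
  consequences e₁ e₂ ex₁ ex₂ rewrite IsEx-unique ex₁ (ex-IsEx _) | IsEx-unique ex₂ (ex-IsEx _) =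
    ℚ-lower-bound-step {+ (q * (q + 1) ^ 2) / 2} {α} {r} {j} {q} {ex (q ^ 2 + q + 1 ∸ r)} {ex (q ^ 2 + q + 1 ∸ r₀)}
      ⅕≤α (bound-at-r _ (ex-IsEx _)) drops ,
    drop′ ,
    min-degree (m+1∸n≡suc[m∸n] (≤-trans r₀≤3r (≤-trans (10r≤3q⇒3r≤q {q} {r} 10r≤3q) (m≤n+m q (q ^ 2)))))
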